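{- Let $G$ and $H$ be graphs on $n_G$ and $n_H$ vertices, respectively. Assume $H$ has no isolated vertices and $H\vee K_1$ abandons a fort. Then $\operatorname{ZIR}(G\circ H)=n_G\operatorname{ZIR}(H\vee K_1)$.
   Context: $H\vee K_1$ is $H$ with an extra vertex adjacent to all vertices of $H$. The corona $G\circ H$ is obtained from $G$ and $n_G$ disjoint copies of $H$ by joining the $i$th vertex of $G$ to every vertex of the $i$th copy of $H$. A fort of a graph is a nonempty vertex subset $F$ such that every vertex $v\notin F$ has $|F\cap N(v)|\neq 1$. For a vertex set $S$ and $x\in S$, a private fort of $x$ relative to $S$ is a fort $F$ with $S\cap F=\{x\}$; $S$ is a ZIr-set if every element has a private fort. $\operatorname{ZIR}(G)$ is the maximum cardinality of an inclusion-maximal ZIr-set; an upper ZIR set is an inclusion-maximal ZIr-set of cardinality $\operatorname{ZIR}(G)$. For a maximal ZIr-set $S_0$, an abandoned fort relative to $S_0$ is a fort containing no element of $S_0$. A graph abandons a fort if some upper ZIR set of it has an abandoned fort. -}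

module Defs where

open import Data.Nat using (ℕ; suc; _+_; _*_; _≤_)
open import Data.Bool using (Bool; true; false; _∧_)
open import Data.Fin using (Fin; zero; suc; splitAt; remQuot)
open import Data.Fin.Properties using (_≟_)
open import Data.Fin.Subset using (Subset; _∈_; _∉_; _⊆_; _∩_; ∣_∣; ⁅_⁆; Nonempty; ⊥)
open import Data.Vec using (tabulate)
open import Data.Sum using (inj₁; inj₂)
open import Data.Product using (Σ; ∃; _×_; _,_)
open import Relation.Nullary using (¬_)
open import Relation.Nullary.Decidable using (⌊_⌋)
open import Relation.Binary.PropositionalEquality using (_≡_; _≢_)

Graph : ℕ → Set
Graph n = Fin n → Fin n → Bool

IsSimple : ∀ {n} → Graph n → Set
IsSimple {n} G = (∀ u v → G u v ≡ G v u) × (∀ v → G v v ≡ false)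

N : ∀ {n} → Graph n → Fin n → Subset n
N G v = tabulate (G v)

NoIsolated : ∀ {n} → Graph n → Set
NoIsolated {n} G = ∀ (v : Fin n) → ∃ λ u → G v u ≡ true

-- H ∨ K₁ : vertex zero is the new universal vertex, suc a is vertex a of H.
joinK1 : ∀ {n} → Graph n → Graph (suc n)
joinK1 H zero    zero    = false
joinK1 H zero    (suc b) = true
joinK1 H (suc a) zero    = true
joinK1 H (suc a) (suc b) = H a b

-- Corona G ∘ H on Fin (nG + nG * nH): the first nG vertices are G's vertices,
-- the vertex of Fin (nG * nH) with remQuot = (i , a) is vertex a of the i-th copy of H.
corona : ∀ {nG nH} → Graph nG → Graph nH → Graph (nG + nG * nH)
corona {nG} {nH} G H x y with splitAt nG x | splitAt nG y
... | inj₁ i | inj₁ j = G i j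
... | inj₁ i | inj₂ q with remQuot {nG} nH q
...   | (j , _) = ⌊ i ≟ j ⌋
corona {nG} {nH} G H x y | inj₂ p | inj₁ j with remQuot {nG} nH p
...   | (i , _) = ⌊ i ≟ j ⌋
corona {nG} {nH} G H x y | inj₂ p | inj₂ q with remQuot {nG} nH p | remQuot {nG} nH q
...   | (i , a) | (j , b) = ⌊ i ≟ j ⌋ ∧ H a b

IsFort : ∀ {n} → Graph n → Subset n → Set
IsFort {n} G F = Nonempty F × (∀ (v : Fin n) → v ∉ F → ∣ F ∩ N G v ∣ ≢ 1)

PrivateFort : ∀ {n} → Graph n → Subset n → Fin n → Subset n → Set
PrivateFort G S x F = IsFort G F × (S ∩ F ≡ ⁅ x ⁆)

IsZIr : ∀ {n} → Graph n → Subset n → Set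
IsZIr {n} G S = ∀ (x : Fin n) → x ∈ S → ∃ λ F → PrivateFort G S x F

IsMaximalZIr : ∀ {n} → Graph n → Subset n → Set
IsMaximalZIr {n} G S = IsZIr G S × (∀ (T : Subset n) → S ⊆ T → IsZIr G T → T ≡ S)

IsZIR : ∀ {n} → Graph n → ℕ → Set
IsZIR {n} G k =
  (∃ λ (S : Subset n) → IsMaximalZIr G S × ∣ S ∣ ≡ k) ×
  (∀ (S : Subset n) → IsMaximalZIr G S → ∣ S ∣ ≤ k)

IsUpperZIR : ∀ {n} → Graph n → Subset n → Set
IsUpperZIR {n} G S = IsMaximalZIr G S × (∀ (T : Subset n) → IsMaximalZIr G T → ∣ T ∣ ≤ ∣ S ∣)

IsAbandonedFort : ∀ {n} → Graph n → Subset n → Subset n → Set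
IsAbandonedFort G S F = IsFort G F × (S ∩ F ≡ ⊥)

AbandonsFort : ∀ {n} → Graph n → Set
AbandonsFort {n} G = ∃ λ (S : Subset n) → IsUpperZIR G S × (∃ λ F → IsAbandonedFort G S F)

-- A vertex of G ∘ H is a pair (i , u) with i a vertex of G and u a vertex of H ∨ K₁, the cone
-- vertex zero standing for i itself; inside each copy G ∘ H looks like H ∨ K₁, and the only
-- other edges are those of G between cone vertices. Since a vertex of a copy of H has all its
-- neighbours in that copy and H has no isolated vertices, every fort of G ∘ H meets each copy
-- in a fort of H ∨ K₁ or not at all. Hence a ZIr-set of G ∘ H meets each copy in a ZIr-set of
-- H ∨ K₁, and ZIR(G ∘ H) ≤ nG · ZIR(H ∨ K₁). Conversely, an upper ZIR set S₀ of H ∨ K₁ placed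
-- in every copy is a maximal ZIr-set of G ∘ H: a private fort of (i , u) is the private fort
-- of u placed in copy i together with the fort abandoned by S₀ in every other copy.

module Submission where

open import Defs
open import Data.Bool using (Bool; true; false; _∧_; if_then_else_)
open import Data.Bool.Properties using (T-≡) renaming (_≟_ to _≟ᵇ_)
open import Data.Fin using (Fin; zero; suc; _↑ˡ_; _↑ʳ_; combine; remQuot; splitAt)
open import Data.Fin.Properties
  using (_≟_; all?; splitAt-↑ˡ; splitAt-↑ʳ; splitAt⁻¹-↑ˡ; splitAt⁻¹-↑ʳ; remQuot-combine; combine-remQuot)
open import Data.Fin.Subset
  using (Subset; inside; outside; _∈_; _∉_; _⊆_; _⊃_; _∩_; ∣_∣; ⁅_⁆; Nonempty; ⊥)
open import Data.Fin.Subset.Induction using (Acc; acc; ⊃-wellFounded)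
open import Data.Fin.Subset.Properties
  using (_∈?_; _⊂?_; nonempty?; anySubset?; x∈⁅x⁆; x∈⁅y⁆⇒x≡y; x∈p∩q⁺; x∈p∩q⁻; ∉⊥; ∣⁅x⁆∣≡1;
         ⊆-refl; ⊆-trans; ⊆-antisym; p⊂q⇒p⊆q; p⊆q⇒∣p∣≤∣q∣)
open import Data.Nat using (ℕ; zero; suc; _+_; _*_; _≤_; z≤n) renaming (_≟_ to _≟ℕ_)
open import Data.Nat.Properties
  using (+-0-commutativeMonoid; +-assoc; +-mono-≤; suc-injective; ≤-trans; ≤-antisym; module ≤-Reasoning)
open import Algebra.Properties.CommutativeMonoid.Sum +-0-commutativeMonoid
  using (sum; sum-syntax; sum-cong-≗; ∑-distrib-+)
open import Data.Product using (∃; ∃!; _×_; _,_; proj₁; proj₂; uncurry; map₂)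
open import Data.Sum using (inj₁; inj₂)
open import Data.Vec using ([]; _∷_; tabulate; lookup)
open import Data.Vec.Functional using (updateAt)
open import Data.Vec.Functional.Properties using (updateAt-updates; updateAt-minimal)
open import Data.Vec.Properties
  using (≡-dec; []=⇒lookup; lookup⇒[]=; lookup∘tabulate; tabulate∘lookup; tabulate-cong)
open import Function using (_∘_; const)
open import Function.Bundles using (Equivalence)
open import Level using (Level)
open import Relation.Nullary using (¬_; yes; no; contradiction)
open import Relation.Nullary.Decidable using (⌊_⌋; toWitness; _×-dec_; _→-dec_; ¬?; decidable-stable)
open import Relation.Unary using (Pred; Decidable)
open import Relation.Binary.PropositionalEquality

private
  variable
    ℓ : Level
    n : ℕ
    x : Fin n
    p : Subset n

∧≡true⇒ˡ : ∀ {a b} → a ∧ b ≡ true → a ≡ true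
∧≡true⇒ˡ {true} _ = refl

⌊i≟i⌋ : (i : Fin n) → ⌊ i ≟ i ⌋ ≡ true
⌊i≟i⌋ i = cong ⌊_⌋ (≡-≟-identity _≟_ (refl {x = i}))

⌊i≟j⌋⇒i≡j : {i j : Fin n} → ⌊ i ≟ j ⌋ ≡ true → i ≡ j
⌊i≟j⌋⇒i≡j = toWitness ∘ Equivalence.from T-≡

∣p∣≡0⇒p≡⊥ : (p : Subset n) → ∣ p ∣ ≡ 0 → p ≡ ⊥
∣p∣≡0⇒p≡⊥ []            _  = refl
∣p∣≡0⇒p≡⊥ (outside ∷ p) eq = cong (outside ∷_) (∣p∣≡0⇒p≡⊥ p eq)

∣p∣≡1⇒p≡⁅x⁆ : (p : Subset n) → ∣ p ∣ ≡ 1 → ∃ λ x → p ≡ ⁅ x ⁆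
∣p∣≡1⇒p≡⁅x⁆ (inside  ∷ p) eq = zero , cong (inside ∷_) (∣p∣≡0⇒p≡⊥ p (suc-injective eq))
∣p∣≡1⇒p≡⁅x⁆ (outside ∷ p) eq with ∣p∣≡1⇒p≡⁅x⁆ p eq
... | x , refl = suc x , refl

p≡⁅x⁆⇒unique : p ≡ ⁅ x ⁆ → x ∈ p × (∀ {y} → y ∈ p → x ≡ y)
p≡⁅x⁆⇒unique {x = x} refl = x∈⁅x⁆ x , λ y∈⁅x⁆ → sym (x∈⁅y⁆⇒x≡y x y∈⁅x⁆)

unique⇒p≡⁅x⁆ : x ∈ p → (∀ {y} → y ∈ p → x ≡ y) → p ≡ ⁅ x ⁆
unique⇒p≡⁅x⁆ {x = x} {p = p} x∈p unique = ⊆-antisym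
  (λ y∈p → subst (_∈ ⁅ x ⁆) (unique y∈p) (x∈⁅x⁆ x))
  (λ y∈⁅x⁆ → subst (_∈ p) (sym (x∈⁅y⁆⇒x≡y x y∈⁅x⁆)) x∈p)

∩≡⁅x⁆⁺ : ∀ {S F : Subset n} → x ∈ S → x ∈ F → (∀ {y} → y ∈ S → y ∈ F → x ≡ y) → S ∩ F ≡ ⁅ x ⁆
∩≡⁅x⁆⁺ {S = S} {F} x∈S x∈F unique =
  unique⇒p≡⁅x⁆ (x∈p∩q⁺ (x∈S , x∈F)) λ y∈ → let y∈S , y∈F = x∈p∩q⁻ S F y∈ in unique y∈S y∈F

∩≡⁅x⁆⁻ : ∀ {S F : Subset n} → S ∩ F ≡ ⁅ x ⁆ → x ∈ F × (∀ {y} → y ∈ S → y ∈ F → x ≡ y)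
∩≡⁅x⁆⁻ {S = S} {F} eq with x∈ , unique ← p≡⁅x⁆⇒unique eq =
  proj₂ (x∈p∩q⁻ S F x∈) , λ y∈S y∈F → unique (x∈p∩q⁺ (y∈S , y∈F))

∣p∣≡1⇒∃! : (p : Subset n) → ∣ p ∣ ≡ 1 → ∃! _≡_ (_∈ p)
∣p∣≡1⇒∃! p eq with x , p≡⁅x⁆ ← ∣p∣≡1⇒p≡⁅x⁆ p eq = x , p≡⁅x⁆⇒unique p≡⁅x⁆

∃!⇒∣p∣≡1 : ∃! _≡_ (_∈ p) → ∣ p ∣ ≡ 1
∃!⇒∣p∣≡1 (x , x∈p , unique) = subst (λ q → ∣ q ∣ ≡ 1) (sym (unique⇒p≡⁅x⁆ x∈p unique)) (∣⁅x⁆∣≡1 x)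

∈-tabulate⁺ : (f : Fin n → Bool) → f x ≡ true → x ∈ tabulate f
∈-tabulate⁺ {x = x} f fx = lookup⇒[]= x (tabulate f) (trans (lookup∘tabulate f x) fx)

∈-tabulate⁻ : (f : Fin n → Bool) → x ∈ tabulate f → f x ≡ true
∈-tabulate⁻ {x = x} f x∈ = trans (sym (lookup∘tabulate f x)) ([]=⇒lookup x∈)

Maximal : Pred (Subset n) ℓ → Subset n → Set ℓ
Maximal P S = P S × (∀ T → S ⊆ T → P T → T ≡ S)

module _ {P : Pred (Subset n) ℓ} (P? : Decidable P) where

  extend-to-maximal : ∀ S → P S → ∃ λ T → S ⊆ T × Maximal P T
  extend-to-maximal S PS = go S PS (⊃-wellFounded S)
    where
    go : ∀ S → P S → Acc _⊃_ S → ∃ λ T → S ⊆ T × Maximal P T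
    go S PS (acc rec) with anySubset? (λ T → S ⊂? T ×-dec P? T)
    ... | yes (T , S⊂T , PT) with U , T⊆U , maxU ← go T PT (rec S⊂T) =
      U , ⊆-trans (p⊂q⇒p⊆q S⊂T) T⊆U , maxU
    ... | no ∄larger = S , ⊆-refl , PS , λ T S⊆T PT → ⊆-antisym
      (λ {x} x∈T → decidable-stable (x ∈? S) (λ x∉S → ∄larger (T , (S⊆T , x , x∈T , x∉S) , PT)))
      S⊆T

module _ (G : Graph n) where

  NeighbourIn : Subset n → Fin n → Fin n → Set
  NeighbourIn F v w = w ∈ F × G v w ≡ true

  UniqueNeighbourIn : Subset n → Fin n → Set
  UniqueNeighbourIn F v = ∃! _≡_ (NeighbourIn F v)

  ∈-∩N⁺ : ∀ {F v w} → NeighbourIn F v w → w ∈ F ∩ N G v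
  ∈-∩N⁺ {v = v} (w∈F , vw) = x∈p∩q⁺ (w∈F , ∈-tabulate⁺ (G v) vw)

  ∈-∩N⁻ : ∀ {F v w} → w ∈ F ∩ N G v → NeighbourIn F v w
  ∈-∩N⁻ {F} {v} w∈ with w∈F , w∈N ← x∈p∩q⁻ F (N G v) w∈ = w∈F , ∈-tabulate⁻ (G v) w∈N

  fort⁺ : ∀ {F} → Nonempty F → (∀ v → v ∉ F → ¬ UniqueNeighbourIn F v) → IsFort G F
  fort⁺ {F} ne noUnique = ne , λ v v∉F one →
    let w , w∈ , unique = ∣p∣≡1⇒∃! (F ∩ N G v) one
    in noUnique v v∉F (w , ∈-∩N⁻ w∈ , unique ∘ ∈-∩N⁺)

  fort⁻ : ∀ {F} → IsFort G F → ∀ v → v ∉ F → ¬ UniqueNeighbourIn F v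
  fort⁻ (_ , noOne) v v∉F (w , nb , unique) = noOne v v∉F (∃!⇒∣p∣≡1 (w , ∈-∩N⁺ nb , unique ∘ ∈-∩N⁻))

  fort? : Decidable (IsFort G)
  fort? F = nonempty? F ×-dec all? λ v → ¬? (v ∈? F) →-dec ¬? (∣ F ∩ N G v ∣ ≟ℕ 1)

  ZIr? : Decidable (IsZIr G)
  ZIr? S = all? λ x → x ∈? S →-dec anySubset? λ F → fort? F ×-dec ≡-dec _≟ᵇ_ (S ∩ F) ⁅ x ⁆

  ZIr⇒∣∣≤ZIR : ∀ {k S} → IsZIR G k → IsZIr G S → ∣ S ∣ ≤ k
  ZIr⇒∣∣≤ZIR {S = S} (_ , bound) ZIrS with T , S⊆T , maxT ← extend-to-maximal ZIr? S ZIrS =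
    ≤-trans (p⊆q⇒∣p∣≤∣q∣ S⊆T) (bound T maxT)

  upperZIR⇒∣∣≡ZIR : ∀ {k S} → IsZIR G k → IsUpperZIR G S → ∣ S ∣ ≡ k
  upperZIR⇒∣∣≡ZIR ((T , maxT , ∣T∣≡k) , bound) (maxS , upper) =
    ≤-antisym (bound _ maxS) (subst (_≤ _) ∣T∣≡k (upper T maxT))

indicator : Bool → ℕ
indicator b = if b then 1 else 0

∣p∣≡∑ : (p : Subset n) → ∣ p ∣ ≡ ∑[ x < n ] indicator (lookup p x)
∣p∣≡∑ []            = refl
∣p∣≡∑ (outside ∷ p) = ∣p∣≡∑ p
∣p∣≡∑ (inside  ∷ p) = cong suc (∣p∣≡∑ p)

∑-↑ : ∀ m (f : Fin (m + n) → ℕ) → sum f ≡ sum (f ∘ (_↑ˡ n)) + sum (f ∘ (m ↑ʳ_))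
∑-↑ zero    f = refl
∑-↑ {n = n} (suc m) f = begin
  f zero + sum (f ∘ suc)                                        ≡⟨ cong (f zero +_) (∑-↑ m (f ∘ suc)) ⟩
  f zero + (sum (f ∘ suc ∘ (_↑ˡ n)) + sum (f ∘ suc ∘ (m ↑ʳ_)))  ≡⟨ +-assoc (f zero) _ _ ⟨
  f zero + sum (f ∘ suc ∘ (_↑ˡ n)) + sum (f ∘ suc ∘ (m ↑ʳ_))    ∎
  where open ≡-Reasoning

∑-combine : ∀ m (f : Fin (m * n) → ℕ) → sum f ≡ ∑[ i < m ] ∑[ a < n ] f (combine i a)
∑-combine         zero    f = refl
∑-combine {n = n} (suc m) f =
  trans (∑-↑ n f) (cong (sum (f ∘ (_↑ˡ m * n)) +_) (∑-combine m (f ∘ (n ↑ʳ_))))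

∑-const : ∀ m c → ∑[ i < m ] c ≡ m * c
∑-const zero    c = refl
∑-const (suc m) c = cong (c +_) (∑-const m c)

∑-mono-≤ : {f g : Fin n → ℕ} → (∀ i → f i ≤ g i) → sum f ≤ sum g
∑-mono-≤ {zero}  f≤g = z≤n
∑-mono-≤ {suc n} f≤g = +-mono-≤ (f≤g zero) (∑-mono-≤ (f≤g ∘ suc))

module Corona {nG nH : ℕ} (G : Graph nG) (H : Graph nH) where

  G∘H : Graph (nG + nG * nH)
  G∘H = corona G H

  H∨K₁ : Graph (suc nH)
  H∨K₁ = joinK1 H

  vertex : Fin nG → Fin (suc nH) → Fin (nG + nG * nH)
  vertex i zero    = i ↑ˡ (nG * nH)
  vertex i (suc a) = nG ↑ʳ combine i a

  coordinates : Fin (nG + nG * nH) → Fin nG × Fin (suc nH)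
  coordinates x with splitAt nG x
  ... | inj₁ i = i , zero
  ... | inj₂ q = map₂ suc (remQuot nH q)

  coordinates-vertex : ∀ i u → coordinates (vertex i u) ≡ (i , u)
  coordinates-vertex i zero    rewrite splitAt-↑ˡ nG i (nG * nH) = refl
  coordinates-vertex i (suc a) rewrite splitAt-↑ʳ nG (nG * nH) (combine i a) =
    cong (map₂ suc) (remQuot-combine i a)

  vertex-coordinates : ∀ x → uncurry vertex (coordinates x) ≡ x
  vertex-coordinates x with splitAt nG x in eq
  ... | inj₁ i = splitAt⁻¹-↑ˡ eq
  ... | inj₂ q = trans (cong (nG ↑ʳ_) (combine-remQuot {nG} nH q)) (splitAt⁻¹-↑ʳ eq)

  vertex-injectiveʳ : ∀ {i u v} → vertex i u ≡ vertex i v → u ≡ v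
  vertex-injectiveʳ {i} {u} {v} eq = cong proj₂
    (trans (sym (coordinates-vertex i u)) (trans (cong coordinates eq) (coordinates-vertex i v)))

  data Located : Fin (nG + nG * nH) → Set where
    at : ∀ i u → Located (vertex i u)

  locate : ∀ x → Located x
  locate x = subst Located (vertex-coordinates x) (at (proj₁ (coordinates x)) (proj₂ (coordinates x)))

  G∘H-within-copy : ∀ {i} → G i i ≡ false → ∀ u v → G∘H (vertex i u) (vertex i v) ≡ H∨K₁ u v
  G∘H-within-copy {i} Gii zero zero
    rewrite splitAt-↑ˡ nG i (nG * nH) = Gii
  G∘H-within-copy {i} Gii zero (suc b)
    rewrite splitAt-↑ˡ nG i (nG * nH) | splitAt-↑ʳ nG (nG * nH) (combine i b) =
    trans (cong (λ (j , _) → ⌊ i ≟ j ⌋) (remQuot-combine i b)) (⌊i≟i⌋ i)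
  G∘H-within-copy {i} Gii (suc a) zero
    rewrite splitAt-↑ʳ nG (nG * nH) (combine i a) | splitAt-↑ˡ nG i (nG * nH) =
    trans (cong (λ (j , _) → ⌊ j ≟ i ⌋) (remQuot-combine i a)) (⌊i≟i⌋ i)
  G∘H-within-copy {i} Gii (suc a) (suc b)
    rewrite splitAt-↑ʳ nG (nG * nH) (combine i a) | splitAt-↑ʳ nG (nG * nH) (combine i b) =
    trans (cong₂ (λ (j , a) (k , b) → ⌊ j ≟ k ⌋ ∧ H a b) (remQuot-combine i a) (remQuot-combine i b))
          (cong (_∧ H a b) (⌊i≟i⌋ i))

  G∘H-H-vertex-local : ∀ {i a j} v → G∘H (vertex i (suc a)) (vertex j v) ≡ true → i ≡ j
  G∘H-H-vertex-local {i} {a} {j} zero adj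
    rewrite splitAt-↑ʳ nG (nG * nH) (combine i a) | splitAt-↑ˡ nG j (nG * nH) =
    ⌊i≟j⌋⇒i≡j (subst (λ (k , _) → ⌊ k ≟ j ⌋ ≡ true) (remQuot-combine i a) adj)
  G∘H-H-vertex-local {i} {a} {j} (suc b) adj
    rewrite splitAt-↑ʳ nG (nG * nH) (combine i a) | splitAt-↑ʳ nG (nG * nH) (combine j b) =
    ⌊i≟j⌋⇒i≡j (∧≡true⇒ˡ (subst₂ (λ (k , a) (l , b) → ⌊ k ≟ l ⌋ ∧ H a b ≡ true)
                                   (remQuot-combine i a) (remQuot-combine j b) adj))

  restrict : Fin nG → Subset (nG + nG * nH) → Subset (suc nH)
  restrict i X = tabulate (λ u → lookup X (vertex i u))

  blocks : (Fin nG → Subset (suc nH)) → Subset (nG + nG * nH)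
  blocks A = tabulate (λ x → uncurry (lookup ∘ A) (coordinates x))

  ∈-restrict⁺ : ∀ {X} i u → vertex i u ∈ X → u ∈ restrict i X
  ∈-restrict⁺ {X} i u = ∈-tabulate⁺ (lookup X ∘ vertex i) ∘ []=⇒lookup

  ∈-restrict⁻ : ∀ {X} i {u} → u ∈ restrict i X → vertex i u ∈ X
  ∈-restrict⁻ {X} i {u} = lookup⇒[]= (vertex i u) X ∘ ∈-tabulate⁻ (lookup X ∘ vertex i)

  restrict-blocks : ∀ A i → restrict i (blocks A) ≡ A i
  restrict-blocks A i = begin
    tabulate (λ u → lookup (blocks A) (vertex i u))
      ≡⟨ tabulate-cong (lookup∘tabulate a ∘ vertex i) ⟩
    tabulate (λ u → a (vertex i u))
      ≡⟨ tabulate-cong (cong (uncurry (lookup ∘ A)) ∘ coordinates-vertex i) ⟩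
    tabulate (lookup (A i))
      ≡⟨ tabulate∘lookup (A i) ⟩
    A i
      ∎
    where
    open ≡-Reasoning
    a : Fin (nG + nG * nH) → Bool
    a = uncurry (lookup ∘ A) ∘ coordinates

  ∈-blocks⁺ : ∀ A i {u} → u ∈ A i → vertex i u ∈ blocks A
  ∈-blocks⁺ A i = ∈-restrict⁻ i ∘ subst (_ ∈_) (sym (restrict-blocks A i))

  ∈-blocks⁻ : ∀ A i u → vertex i u ∈ blocks A → u ∈ A i
  ∈-blocks⁻ A i u = subst (u ∈_) (restrict-blocks A i) ∘ ∈-restrict⁺ i u

  ∣X∣≡∑∣restrict∣ : ∀ X → ∣ X ∣ ≡ ∑[ i < nG ] ∣ restrict i X ∣
  ∣X∣≡∑∣restrict∣ X = begin
    ∣ X ∣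
      ≡⟨ ∣p∣≡∑ X ⟩
    ∑[ x < nG + nG * nH ] χ x
      ≡⟨ ∑-↑ nG χ ⟩
    ∑[ i < nG ] χ (vertex i zero) + ∑[ q < nG * nH ] χ (nG ↑ʳ q)
      ≡⟨ cong (∑[ i < nG ] χ (vertex i zero) +_) (∑-combine nG (χ ∘ (nG ↑ʳ_))) ⟩
    ∑[ i < nG ] χ (vertex i zero) + ∑[ i < nG ] ∑[ a < nH ] χ (vertex i (suc a))
      ≡⟨ ∑-distrib-+ (λ i → χ (vertex i zero)) (λ i → ∑[ a < nH ] χ (vertex i (suc a))) ⟨
    ∑[ i < nG ] ∑[ u < suc nH ] χ (vertex i u)
      ≡⟨ sum-cong-≗ (λ i → sym (∣restrict∣ i)) ⟩
    ∑[ i < nG ] ∣ restrict i X ∣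
      ∎
    where
    open ≡-Reasoning
    χ : Fin (nG + nG * nH) → ℕ
    χ = indicator ∘ lookup X
    ∣restrict∣ : ∀ i → ∣ restrict i X ∣ ≡ ∑[ u < suc nH ] χ (vertex i u)
    ∣restrict∣ i =
      trans (∣p∣≡∑ (restrict i X)) (sum-cong-≗ (cong indicator ∘ lookup∘tabulate (lookup X ∘ vertex i)))

  ∣blocks∣ : ∀ A → ∣ blocks A ∣ ≡ ∑[ i < nG ] ∣ A i ∣
  ∣blocks∣ A = trans (∣X∣≡∑∣restrict∣ (blocks A)) (sum-cong-≗ (cong ∣_∣ ∘ restrict-blocks A))

  module _ (G-loopless : ∀ i → G i i ≡ false) where

    neighbour-restrict⁺ : ∀ {F} i u v → NeighbourIn G∘H F (vertex i u) (vertex i v) →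
                          NeighbourIn H∨K₁ (restrict i F) u v
    neighbour-restrict⁺ i u v (v∈F , adj) =
      ∈-restrict⁺ i v v∈F , trans (sym (G∘H-within-copy (G-loopless i) u v)) adj

    neighbour-restrict⁻ : ∀ {F} i u v → NeighbourIn H∨K₁ (restrict i F) u v →
                          NeighbourIn G∘H F (vertex i u) (vertex i v)
    neighbour-restrict⁻ i u v (v∈F , adj) =
      ∈-restrict⁻ i v∈F , trans (G∘H-within-copy (G-loopless i) u v) adj

    unique-restrict : ∀ {F} i u → UniqueNeighbourIn G∘H F (vertex i u) →
                      ∃ (NeighbourIn H∨K₁ (restrict i F) u) → UniqueNeighbourIn H∨K₁ (restrict i F) u
    unique-restrict i u (_ , _ , unique) (v , nb) = v , nb , λ {v′} nb′ →
      vertex-injectiveʳ (trans (sym (unique (neighbour-restrict⁻ i u v nb)))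
                               (unique (neighbour-restrict⁻ i u v′ nb′)))

    unique-restrict-H-vertex : ∀ {F} i a → UniqueNeighbourIn G∘H F (vertex i (suc a)) →
                               UniqueNeighbourIn H∨K₁ (restrict i F) (suc a)
    unique-restrict-H-vertex i a uniq@(x , nb , _) with locate x
    ... | at j v with refl ← G∘H-H-vertex-local v (proj₂ nb) =
      unique-restrict i (suc a) uniq (v , neighbour-restrict⁺ i (suc a) v nb)

    unique-lift-H-vertex : ∀ {F} i a → UniqueNeighbourIn H∨K₁ (restrict i F) (suc a) →
                           UniqueNeighbourIn G∘H F (vertex i (suc a))
    unique-lift-H-vertex {F} i a (v , nb , unique) =
      vertex i v , neighbour-restrict⁻ i (suc a) v nb , unique′
      where
      unique′ : ∀ {x} → NeighbourIn G∘H F (vertex i (suc a)) x → vertex i v ≡ x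
      unique′ {x} nbx with locate x
      ... | at j w with refl ← G∘H-H-vertex-local w (proj₂ nbx) =
        cong (vertex i) (unique (neighbour-restrict⁺ i (suc a) w nbx))

    blocks-fort : ∀ {A} → (∀ i → IsFort H∨K₁ (A i)) → Fin nG → IsFort G∘H (blocks A)
    blocks-fort {A} forts i with u , u∈ ← proj₁ (forts i) =
      fort⁺ G∘H (vertex i u , ∈-blocks⁺ A i u∈) noUnique
      where
      fortʳ : ∀ j → IsFort H∨K₁ (restrict j (blocks A))
      fortʳ j = subst (IsFort H∨K₁) (sym (restrict-blocks A j)) (forts j)
      noUnique : ∀ y → y ∉ blocks A → ¬ UniqueNeighbourIn G∘H (blocks A) y
      noUnique y y∉ uniq with locate y
      ... | at j (suc b) =
        fort⁻ H∨K₁ (fortʳ j) (suc b) (y∉ ∘ ∈-restrict⁻ j) (unique-restrict-H-vertex j b uniq)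
      ... | at j zero with proj₁ (fortʳ j)
      ...   | zero  , cone∈ = y∉ (∈-restrict⁻ j cone∈)
      ...   | suc c , c∈   =
        fort⁻ H∨K₁ (fortʳ j) zero (y∉ ∘ ∈-restrict⁻ j) (unique-restrict j zero uniq (suc c , c∈ , refl))

    blocks-ZIr : ∀ {A} → (∀ i → IsZIr H∨K₁ (A i)) → (∀ i → ∃ (IsAbandonedFort H∨K₁ (A i))) →
                 IsZIr G∘H (blocks A)
    blocks-ZIr {A} ZIrA abandoned x x∈ with locate x
    ... | at i u with Fᵤ , fortᵤ , Aᵢ∩Fᵤ≡⁅u⁆ ← ZIrA i u (∈-blocks⁻ A i u x∈) =
      blocks B , blocks-fort fortB i , ∩≡⁅x⁆⁺ x∈ (∈-blocks⁺ B i u∈Bᵢ) unique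
      where
      F₀ : Fin nG → Subset (suc nH)
      F₀ = proj₁ ∘ abandoned
      B : Fin nG → Subset (suc nH)
      B = updateAt F₀ i (const Fᵤ)
      u∈Bᵢ : u ∈ B i
      u∈Bᵢ = subst (u ∈_) (sym (updateAt-updates i F₀)) (proj₁ (∩≡⁅x⁆⁻ Aᵢ∩Fᵤ≡⁅u⁆))
      fortB : ∀ j → IsFort H∨K₁ (B j)
      fortB j with j ≟ i
      ... | yes refl = subst (IsFort H∨K₁) (sym (updateAt-updates i F₀)) fortᵤ
      ... | no j≢i   =
        subst (IsFort H∨K₁) (sym (updateAt-minimal j i F₀ j≢i)) (proj₁ (proj₂ (abandoned j)))
      unique : ∀ {y} → y ∈ blocks A → y ∈ blocks B → vertex i u ≡ y
      unique {y} y∈A y∈B with locate y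
      ... | at j v with j ≟ i | ∈-blocks⁻ A j v y∈A | ∈-blocks⁻ B j v y∈B
      ...   | yes refl | v∈A | v∈B = cong (vertex i)
        (proj₂ (∩≡⁅x⁆⁻ Aᵢ∩Fᵤ≡⁅u⁆) v∈A (subst (v ∈_) (updateAt-updates i F₀) v∈B))
      ...   | no j≢i   | v∈A | v∈B = contradiction (subst (v ∈_) (proj₂ (proj₂ (abandoned j)))
        (x∈p∩q⁺ (v∈A , subst (v ∈_) (updateAt-minimal j i F₀ j≢i) v∈B))) ∉⊥

    module _ (H-simple : IsSimple H) (H-noIsolated : NoIsolated H) where

      restrict-fort : ∀ {F} i u → IsFort G∘H F → vertex i u ∈ F → IsFort H∨K₁ (restrict i F)
      restrict-fort {F} i u fortF u∈F = fort⁺ H∨K₁ (u , ∈-restrict⁺ i u u∈F) noUnique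
        where
        noUnique : ∀ v → v ∉ restrict i F → ¬ UniqueNeighbourIn H∨K₁ (restrict i F) v
        noUnique (suc b) b∉ uniq =
          fort⁻ G∘H fortF (vertex i (suc b)) (b∉ ∘ ∈-restrict⁺ i (suc b)) (unique-lift-H-vertex i b uniq)
        noUnique zero cone∉ (zero  , (_ , ()) , _)
        -- A neighbour b of a in H lies outside F, and its only neighbour in F is then
        -- vertex i (suc a), as a vertex of a copy of H has no neighbours outside its copy.
        noUnique zero cone∉ (suc a , (a∈ , _) , unique) with b , ab ← H-noIsolated a =
          fort⁻ G∘H fortF (vertex i (suc b)) (b∉ ∘ ∈-restrict⁺ i (suc b))
            (unique-lift-H-vertex i b (suc a , (a∈ , ba) , unique′))
          where
          ba : H b a ≡ true
          ba = trans (proj₁ H-simple b a) ab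
          b∉ : suc b ∉ restrict i F
          b∉ b∈ with refl ← unique (b∈ , refl) = contradiction (trans (sym ab) (proj₂ H-simple a)) λ ()
          unique′ : ∀ {w} → NeighbourIn H∨K₁ (restrict i F) (suc b) w → suc a ≡ w
          unique′ {zero}  (cone∈ , _) = contradiction cone∈ cone∉
          unique′ {suc c} (c∈ , _)   = unique (c∈ , refl)

      restrict-ZIr : ∀ {T} → IsZIr G∘H T → ∀ i → IsZIr H∨K₁ (restrict i T)
      restrict-ZIr ZIrT i u u∈T
        with F , fortF , T∩F≡⁅u⁆ ← ZIrT (vertex i u) (∈-restrict⁻ i u∈T)
        with u∈F , unique ← ∩≡⁅x⁆⁻ T∩F≡⁅u⁆ =
        restrict i F , restrict-fort i u fortF u∈F ,
        ∩≡⁅x⁆⁺ u∈T (∈-restrict⁺ i u u∈F)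
          λ w∈T w∈F → vertex-injectiveʳ (unique (∈-restrict⁻ i w∈T) (∈-restrict⁻ i w∈F))

      blocks-maximal : ∀ {A} → (∀ i → IsMaximalZIr H∨K₁ (A i)) → IsZIr G∘H (blocks A) →
                       IsMaximalZIr G∘H (blocks A)
      blocks-maximal {A} maxA ZIrB = ZIrB , λ T B⊆T ZIrT → ⊆-antisym (T⊆B B⊆T ZIrT) B⊆T
        where
        T⊆B : ∀ {T} → blocks A ⊆ T → IsZIr G∘H T → T ⊆ blocks A
        T⊆B {T} B⊆T ZIrT {x} x∈T with locate x
        ... | at i u = ∈-blocks⁺ A i (subst (u ∈_) restrict≡A (∈-restrict⁺ i u x∈T))
          where
          restrict≡A : restrict i T ≡ A i
          restrict≡A =
            proj₂ (maxA i) (restrict i T) (∈-restrict⁺ i _ ∘ B⊆T ∘ ∈-blocks⁺ A i) (restrict-ZIr ZIrT i)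

      ZIr⇒∣∣≤nG*ZIR : ∀ {m T} → IsZIR H∨K₁ m → IsZIr G∘H T → ∣ T ∣ ≤ nG * m
      ZIr⇒∣∣≤nG*ZIR {m} {T} ZIR≡m ZIrT = begin
        ∣ T ∣                         ≡⟨ ∣X∣≡∑∣restrict∣ T ⟩
        ∑[ i < nG ] ∣ restrict i T ∣  ≤⟨ ∑-mono-≤ (λ i → ZIr⇒∣∣≤ZIR H∨K₁ ZIR≡m (restrict-ZIr ZIrT i)) ⟩
        ∑[ i < nG ] m                 ≡⟨ ∑-const nG m ⟩
        nG * m                        ∎
        where open ≤-Reasoning

theorem6p8 : ∀ {nG nH : ℕ} (G : Graph nG) (H : Graph nH) →
    IsSimple G → IsSimple H → NoIsolated H → AbandonsFort (joinK1 H) →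
    ∀ (m : ℕ) → IsZIR (joinK1 H) m → IsZIR (corona G H) (nG * m)
theorem6p8 {nG} {nH} G H (_ , G-loopless) H-simple H-noIsolated (S₀ , upper , F₀ , abandoned) m ZIR≡m =
  (S , S-maximal , ∣S∣≡nG*m) , λ T (ZIrT , _) → ZIr⇒∣∣≤nG*ZIR G-loopless H-simple H-noIsolated ZIR≡m ZIrT
  where
  open Corona G H
  S : Subset (nG + nG * nH)
  S = blocks (λ _ → S₀)
  S-maximal : IsMaximalZIr G∘H S
  S-maximal = blocks-maximal G-loopless H-simple H-noIsolated (λ _ → proj₁ upper)
                (blocks-ZIr G-loopless (λ _ → proj₁ (proj₁ upper)) (λ _ → F₀ , abandoned))
  ∣S∣≡nG*m : ∣ S ∣ ≡ nG * m
  ∣S∣≡nG*m = begin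
    ∣ S ∣              ≡⟨ ∣blocks∣ (λ _ → S₀) ⟩
    ∑[ i < nG ] ∣ S₀ ∣  ≡⟨ ∑-const nG ∣ S₀ ∣ ⟩
    nG * ∣ S₀ ∣         ≡⟨ cong (nG *_) (upperZIR⇒∣∣≡ZIR (joinK1 H) ZIR≡m upper) ⟩
    nG * m             ∎
    where open ≡-Reasoning
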